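{- Let $n\ge 4$, let $S=\Sigma_n$ and let $P=\Sigma_n\setminus D_n$, where $D_n$ is the set of derangements. Then the $(n-2)$-skeleta agree: $\operatorname{sk}_{n-2}|X(P)|=\operatorname{sk}_{n-2}|X(S)|$. (Equivalently, every non-empty injective word of length at most $n-1$ in the alphabet $[n]$ is a subword of some permutation with at least one fixed point.)
   Context: An injective word in the alphabet $[n]=\{1,\dots,n\}$ is a sequence $[i_1\cdots i_k]$ of distinct elements of $[n]$; $\preceq$ denotes the subword (subsequence) relation. A permutation $\sigma\in\Sigma_n$ is identified with the word $[\sigma(1)\cdots\sigma(n)]$. For $T\subseteq\Sigma_n$, $X(T)$ is the set of non-empty injective words that are subwords of some element of $T$, and $|X(T)|$ is the cell complex (geometric realization of a semi-simplicial set) with one $(k-1)$-simplex for each word of length $k$ in $X(T)$, faces given by deleting letters. $\operatorname{sk}_d$ denotes the $d$-skeleton. -}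

module Defs where

open import Data.Nat using (ℕ; suc; _≤_)
open import Data.Fin using (Fin)
open import Data.Fin.Permutation using (Permutation′; _⟨$⟩ʳ_)
open import Data.List using (List; []; length; tabulate)
open import Data.List.Relation.Unary.Unique.Propositional using (Unique)
open import Data.List.Relation.Binary.Sublist.Propositional using (_⊆_)
open import Data.Product using (Σ; _×_)
open import Relation.Binary.PropositionalEquality using (_≡_)
open import Relation.Nullary using (¬_)
open import Data.Unit using (⊤)
open import Level using (0ℓ)

-- A word in the alphabet [n] = Fin n (letters 0..n-1 represent 1..n).
Word : ℕ → Set
Word n = List (Fin n)

Injective : ∀ {n} → Word n → Set
Injective w = Unique w

Perm : ℕ → Set
Perm n = Permutation′ n

wordOf : ∀ {n} → Perm n → Word n
wordOf σ = tabulate (σ ⟨$⟩ʳ_)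

_≼_ : ∀ {n} → Word n → Word n → Set
u ≼ v = u ⊆ v

PermSet : ℕ → Set₁
PermSet n = Perm n → Set

X : ∀ {n} → PermSet n → Word n → Set
X {n} T w = ¬ (w ≡ []) × Injective w × Σ (Perm n) (λ σ → T σ × (w ≼ wordOf σ))

-- Cells of the d-skeleton of |X(T)|: the (k-1)-simplices with k-1 ≤ d,
-- i.e. words of X(T) of length k ≤ d+1. (Faces are determined by the words.)
sk : ∀ {n} → ℕ → PermSet n → Word n → Set
sk d T w = X T w × (length w ≤ suc d)

AllPerms : ∀ n → PermSet n
AllPerms n σ = ⊤

Derangement : ∀ {n} → Perm n → Set
Derangement {n} σ = (i : Fin n) → ¬ (σ ⟨$⟩ʳ i ≡ i)

NonDerangements : ∀ n → PermSet n
NonDerangements n σ = ¬ Derangement σ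

-- Equality of sub-semi-simplicial sets of |X(S)|, as equality of their cell sets.
SameCells : ∀ {n} → (Word n → Set) → (Word n → Set) → Set
SameCells {n} A B = (w : Word n) → (A w → B w) × (B w → A w)

{-# OPTIONS --safe #-}
-- A word of length at most n − 1 misses some letter m. If it is a subword of σ,
-- delete m from σ and reinsert it at position m: the resulting permutation fixes m
-- and still contains the word, since only the unused letter m was moved.
module Submission where

open import Defs
open import Data.Nat using (ℕ; suc; _≤_; _<_; _∸_; s≤s)
open import Data.Fin using (Fin; punchIn; _≟_)
import Data.Fin as Fin
open import Data.Fin.Properties using (pigeonhole; ¬∀⟶∃¬; <⇒≢)
open import Data.Fin.Permutation
  using (Permutation; _⟨$⟩ʳ_; _⟨$⟩ˡ_; insert; remove; insert-punchIn; punchIn-permute′; inverseʳ)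
open import Data.List using (List; []; _∷_; length; tabulate; lookup)
open import Data.List.Properties using (tabulate-cong)
open import Data.List.Membership.Propositional using (_∈_; _∉_)
open import Data.List.Membership.DecPropositional using () renaming (_∈?_ to ∈?)
open import Data.List.Relation.Unary.Any using (here; there; index)
open import Data.List.Relation.Unary.Any.Properties using (lookup-index)
open import Data.List.Relation.Binary.Sublist.Propositional
  using (_⊆_; _∷_; _∷ʳ_; ⊆-refl; ⊆-trans; ⊆-reflexive)
open import Data.Product using (Σ; ∃; _×_; _,_)
open import Data.Unit using (tt)
open import Function using (_∘_)
open import Relation.Binary.PropositionalEquality using (_≡_; refl; sym; trans; cong)
open import Relation.Nullary using (¬_; yes; no; contradiction)

tabulate-punchIn-⊆ : ∀ {A : Set} {n} (f : Fin (suc n) → A) (i : Fin (suc n)) →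
                     tabulate (f ∘ punchIn i) ⊆ tabulate f
tabulate-punchIn-⊆ f Fin.zero = f Fin.zero ∷ʳ ⊆-refl
tabulate-punchIn-⊆ {n = suc n} f (Fin.suc i) = refl ∷ tabulate-punchIn-⊆ (f ∘ Fin.suc) i

⊆-tabulate-punchIn : ∀ {A : Set} {n} (f : Fin (suc n) → A) (i : Fin (suc n)) {w : List A} →
                     w ⊆ tabulate f → f i ∉ w → w ⊆ tabulate (f ∘ punchIn i)
⊆-tabulate-punchIn f Fin.zero (_ ∷ʳ w⊆) fi∉w = w⊆
⊆-tabulate-punchIn f Fin.zero (refl ∷ _) fi∉w = contradiction (here refl) fi∉w
⊆-tabulate-punchIn {n = suc n} f (Fin.suc i) (_ ∷ʳ w⊆) fi∉w =
  f Fin.zero ∷ʳ ⊆-tabulate-punchIn (f ∘ Fin.suc) i w⊆ fi∉w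
⊆-tabulate-punchIn {n = suc n} f (Fin.suc i) (refl ∷ w⊆) fi∉w =
  refl ∷ ⊆-tabulate-punchIn (f ∘ Fin.suc) i w⊆ (fi∉w ∘ there)

length<⇒∃∉ : ∀ {n} (w : Word n) → length w < n → ∃ λ m → m ∉ w
length<⇒∃∉ {n} w length<n = ¬∀⟶∃¬ n (_∈ w) (λ m → ∈? _≟_ m w) ¬all∈
  where
  ¬all∈ : ¬ (∀ m → m ∈ w)
  ¬all∈ all∈ with pigeonhole length<n (index ∘ all∈)
  ... | i , j , i<j , same-index = <⇒≢ i<j (begin
    i                        ≡⟨ lookup-index (all∈ i) ⟩
    lookup w (index (all∈ i)) ≡⟨ cong (lookup w) same-index ⟩
    lookup w (index (all∈ j)) ≡⟨ sym (lookup-index (all∈ j)) ⟩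
    j                        ∎)
    where open Relation.Binary.PropositionalEquality.≡-Reasoning

insert-self : ∀ {m n} (i : Fin (suc m)) (j : Fin (suc n)) (π : Permutation m n) →
              insert i j π ⟨$⟩ʳ i ≡ j
insert-self i j π with i ≟ i
... | yes _ = refl
... | no i≢i = contradiction refl i≢i

⊆-wordOf-fixing : ∀ {n} (σ : Perm (suc n)) (m : Fin (suc n)) {w : Word (suc n)} →
                  w ⊆ wordOf σ → m ∉ w →
                  Σ (Perm (suc n)) λ τ → τ ⟨$⟩ʳ m ≡ m × w ⊆ wordOf τ
⊆-wordOf-fixing σ m {w} w⊆σ m∉w = τ , insert-self m m ρ , w⊆τ
  where
  p = σ ⟨$⟩ˡ m
  ρ = remove p σ
  τ = insert m m ρ

  σ∘punchIn≗τ∘punchIn : ∀ j → σ ⟨$⟩ʳ punchIn p j ≡ τ ⟨$⟩ʳ punchIn m j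
  σ∘punchIn≗τ∘punchIn j = trans (punchIn-permute′ σ m j) (sym (insert-punchIn m m ρ j))

  σp∉w : σ ⟨$⟩ʳ p ∉ w
  σp∉w rewrite inverseʳ σ {m} = m∉w

  w⊆τ : w ⊆ wordOf τ
  w⊆τ = ⊆-trans (⊆-tabulate-punchIn (σ ⟨$⟩ʳ_) p w⊆σ σp∉w)
          (⊆-trans (⊆-reflexive (tabulate-cong σ∘punchIn≗τ∘punchIn))
                   (tabulate-punchIn-⊆ (τ ⟨$⟩ʳ_) m))

short-⊆-wordOf-nonDerangement : ∀ {n} (σ : Perm n) {w : Word n} → w ⊆ wordOf σ → length w < n →
                                Σ (Perm n) λ τ → NonDerangements n τ × w ⊆ wordOf τ
short-⊆-wordOf-nonDerangement {suc n} σ {w} w⊆σ length<n with length<⇒∃∉ w length<n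
... | m , m∉w with ⊆-wordOf-fixing σ m w⊆σ m∉w
...   | τ , τm≡m , w⊆τ = τ , (λ derangement → derangement m τm≡m) , w⊆τ

proposition4p1 : (n : ℕ) → 4 ≤ n →
    SameCells (sk (n ∸ 2) (NonDerangements n)) (sk (n ∸ 2) (AllPerms n))
proposition4p1 (suc (suc k)) (s≤s (s≤s _)) w = forget , fix
  where
  forget : sk k (NonDerangements (suc (suc k))) w → sk k (AllPerms (suc (suc k))) w
  forget ((w≢[] , injective , σ , _ , w⊆σ) , short) = (w≢[] , injective , σ , tt , w⊆σ) , short

  fix : sk k (AllPerms (suc (suc k))) w → sk k (NonDerangements (suc (suc k))) w
  fix ((w≢[] , injective , σ , _ , w⊆σ) , short)
    = let τ , τ-fixes , w⊆τ = short-⊆-wordOf-nonDerangement σ w⊆σ (s≤s short)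
      in (w≢[] , injective , τ , τ-fixes , w⊆τ) , short
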